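{- Let $2\le m\le n$ be integers. Then $d_g(K_{m,n})=\frac{m}{2}$ if $m$ and $n$ are both even, and $d_g(K_{m,n})=\lceil\frac{m+1}{2}\rceil$ otherwise. Moreover, $d_g'(K_{m,n})=\frac{m}{2}$ if $m$ is even and $n$ is odd, and $d_g'(K_{m,n})=\lceil\frac{m+1}{2}\rceil$ otherwise.
   Context: $K_{m,n}$ denotes the complete bipartite graph with parts of sizes $m$ and $n$. For a vertex $x$, $N[x]$ denotes its closed neighborhood. The domatic number game on a graph $G$ with palette $[k]=\{1,\dots,k\}$: two players, Alice and Bob, alternately choose a previously unchosen vertex of $G$ and assign it a color from $[k]$, until every vertex has been colored. Let $V_i$ be the set of vertices colored $i$. Alice wins if every $V_i$ ($i\in[k]$) is a dominating set of $G$, i.e. for every vertex $x$ and every color $c\in[k]$ some vertex of $N[x]$ has color $c$; otherwise Bob wins. In the $A$-game Alice moves first; in the $B$-game Bob moves first. The game domatic number $d_g(G)$ is the largest $k$ for which Alice has a winning strategy in the $A$-game with palette $[k]$, and the delayed game domatic number $d_g'(G)$ is the largest $k$ for which Alice has a winning strategy in the $B$-game with palette $[k]$. -}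

module Defs where

open import Data.Nat using (ℕ; _+_; _<_)
open import Data.Nat.Divisibility using (_∣_)
open import Data.Fin using (Fin; toℕ; _≟_)
open import Data.Maybe using (Maybe; just; nothing; Is-just)
open import Data.Product using (Σ; ∃; _×_; _,_)
open import Data.Sum using (_⊎_)
open import Relation.Nullary using (¬_; yes; no)
open import Relation.Binary.PropositionalEquality using (_≡_)
open import Level using (0ℓ; suc)

record Graph : Set₁ where
  field
    order : ℕ
    Adj   : Fin order → Fin order → Set

open Graph public

-- Complete bipartite graph K_{m,n}: vertices Fin (m + n); the vertices with
-- index < m form the first part, the others the second part; two vertices are
-- adjacent iff they lie in different parts.
K : ℕ → ℕ → Graph
K m n = record
  { order = m + n
  ; Adj   = λ x y → (toℕ x < m × ¬ (toℕ y < m)) ⊎ (¬ (toℕ x < m) × toℕ y < m)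
  }

-- A (partial) colouring with palette [k] = Fin k; nothing = not yet chosen.
Position : Graph → ℕ → Set
Position G k = Fin (order G) → Maybe (Fin k)

emptyPos : (G : Graph) (k : ℕ) → Position G k
emptyPos G k v = nothing

assign : {G : Graph} {k : ℕ} → Position G k → Fin (order G) → Fin k → Position G k
assign {G} c v i w with w ≟ v
... | yes _ = just i
... | no  _ = c w

Complete : {G : Graph} {k : ℕ} → Position G k → Set
Complete {G} c = ∀ (v : Fin (order G)) → Is-just (c v)

AllClassesDominating : {G : Graph} {k : ℕ} → Position G k → Set
AllClassesDominating {G} {k} c =
  ∀ (x : Fin (order G)) (i : Fin k) →
    ∃ λ (y : Fin (order G)) → (y ≡ x ⊎ Adj G x y) × c y ≡ just i

data Player : Set where
  alice bob : Player

-- AliceWins G k p c : Alice has a winning strategy from position c when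
-- player p is to move (palette [k]).
data AliceWins (G : Graph) (k : ℕ) : Player → Position G k → Set where
  finished  : ∀ {p c} → Complete {G} c → AllClassesDominating {G} c →
              AliceWins G k p c
  aliceMove : ∀ {c} (v : Fin (order G)) (i : Fin k) → c v ≡ nothing →
              AliceWins G k bob (assign {G} c v i) →
              AliceWins G k alice c
  bobMove   : ∀ {c} → (∃ λ (v : Fin (order G)) → c v ≡ nothing) →
              (∀ (v : Fin (order G)) (i : Fin k) → c v ≡ nothing →
                 AliceWins G k alice (assign {G} c v i)) →
              AliceWins G k bob c

IsLargestWinning : Player → Graph → ℕ → Set
IsLargestWinning p G d =
  AliceWins G d p (emptyPos G d) ×
  (∀ (k : ℕ) → d < k → ¬ AliceWins G k p (emptyPos G k))

GameDomaticNumber : Graph → ℕ → Set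
GameDomaticNumber = IsLargestWinning alice

DelayedGameDomaticNumber : Graph → ℕ → Set
DelayedGameDomaticNumber = IsLargestWinning bob

Even : ℕ → Set
Even n = 2 ∣ n

-- All colour classes dominate as soon as every colour occurs on both sides.  Conversely, if colour i
-- is missing on A then all of B must carry i, which fails for k ≥ 3, and for k = 2 once B carries two
-- colours or a colour of A.
-- During play a side is described by its number r of uncoloured vertices, its number a of missing
-- colours, and whether it is still fresh (carries no colour).  What matters is the deficit 2a − r: on a
-- started side Bob can answer every new colour by a repeated one, so the side is safe for Alice iff its
-- deficit is at most her tempo (1 when she is to move, 0 otherwise).  On a fresh side the first colour
-- is necessarily new, so deficit 2 is still safe provided Bob is the one forced to open it, which the
-- parity of the free vertices on the other side decides.  Alice keeps both sides in this region; Bob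
-- keeps the smaller side A outside it and, for k = 2, makes B carry two colours or a colour of A in
-- time.  Initially A has deficit 2k − m, so the largest winning k is m/2 when m is even and Alice would
-- be forced to open A, and ⌈(m+1)/2⌉ otherwise.

{-# OPTIONS --safe #-}
module Submission where

open import Data.Bool using (if_then_else_)
open import Data.Empty using (⊥; ⊥-elim)
open import Data.Fin using (Fin; zero; suc; toℕ; fromℕ<)
import Data.Fin.Properties as Fin
open import Data.Maybe using (Maybe; just; nothing)
import Data.Maybe.Properties as Maybe
open import Data.Maybe.Relation.Unary.Any using (just)
open import Data.Nat using (ℕ; zero; suc; _+_; _≤_; _<_; z≤n; s≤s; _<?_; ⌊_/2⌋; ⌈_/2⌉)
open import Data.Nat.Divisibility using (_∣?_; divides; ∣-refl; ∣m∣n⇒∣m+n; ∣m+n∣m⇒∣n; ∣1⇒≡1)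
open import Data.Nat.Properties
  using ( ≤-refl; ≤-reflexive; ≤-trans; ≤-antisym; ≤-pred; <⇒≢; <⇒≱; m≤n⇒m<n∨m≡n; n≤1+n; m≤n⇒m≤1+n
        ; m≤m+n; m≤n⇒m≤o+n; +-mono-≤; +-suc; +-comm; +-identityʳ; *-comm; suc-injective; ⌊n/2⌋-mono
        ; module ≤-Reasoning )
open import Data.Product using (∃; ∃₂; _×_; _,_; proj₁; proj₂; uncurry)
open import Data.Sum using (_⊎_; inj₁; inj₂; [_,_])
import Data.Sum as Sum
open import Data.Unit using (tt)
open import Defs
open import Function using (_∘_; _⇔_; mk⇔; Equivalence)
import Function.Properties.Equivalence as ⇔
open import Function.Related.TypeIsomorphisms using (¬-cong-⇔)
open import Level using (Level; 0ℓ)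
open import Relation.Binary using (DecidableEquality)
open import Relation.Binary.PropositionalEquality
  using (_≡_; _≢_; refl; sym; trans; cong; subst; subst₂; module ≡-Reasoning)
open import Relation.Nullary using (¬_; yes; no; does; ¬?; _×-dec_)
open import Relation.Nullary.Decidable using (does-⇔; decidable-stable)
open import Relation.Unary using (Pred; Decidable)

private variable
  ℓ ℓ′ : Level

-- Counting

count : ∀ {N} {P : Pred (Fin N) ℓ} → Decidable P → ℕ
count {N = zero}  P? = 0
count {N = suc N} P? = if does (P? zero) then suc (count (P? ∘ suc)) else count (P? ∘ suc)

count≤ : ∀ {N} {P : Pred (Fin N) ℓ} (P? : Decidable P) → count P? ≤ N
count≤ {N = zero}  P? = z≤n
count≤ {N = suc N} P? with P? zero
... | yes _ = s≤s (count≤ (P? ∘ suc))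
... | no  _ = m≤n⇒m≤1+n (count≤ (P? ∘ suc))

count-cong : ∀ {N} {P : Pred (Fin N) ℓ} {Q : Pred (Fin N) ℓ′} (P? : Decidable P) (Q? : Decidable Q) →
             (∀ v → P v ⇔ Q v) → count P? ≡ count Q?
count-cong {N = zero}  P? Q? P⇔Q = refl
count-cong {N = suc N} P? Q? P⇔Q with P? zero | Q? zero | does-⇔ (P⇔Q zero) (P? zero) (Q? zero)
... | yes _ | yes _ | _ = cong suc (count-cong (P? ∘ suc) (Q? ∘ suc) (P⇔Q ∘ suc))
... | no  _ | no  _ | _ = count-cong (P? ∘ suc) (Q? ∘ suc) (P⇔Q ∘ suc)

count-flip : ∀ {N} {P : Pred (Fin N) ℓ} {Q : Pred (Fin N) ℓ′} (P? : Decidable P) (Q? : Decidable Q) (v : Fin N) →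
             P v → ¬ Q v → (∀ w → w ≢ v → P w ⇔ Q w) → count P? ≡ suc (count Q?)
count-flip P? Q? zero pv ¬qv P⇔Q with P? zero | Q? zero
... | yes _  | no _  = cong suc (count-cong (P? ∘ suc) (Q? ∘ suc) (λ w → P⇔Q (suc w) λ ()))
... | no ¬pv | _     = ⊥-elim (¬pv pv)
... | yes _  | yes qv = ⊥-elim (¬qv qv)
count-flip P? Q? (suc v) pv ¬qv P⇔Q with P? zero | Q? zero
... | yes _ | yes _ = cong suc (count-flip (P? ∘ suc) (Q? ∘ suc) v pv ¬qv λ w w≢v → P⇔Q (suc w) (w≢v ∘ Fin.suc-injective))
... | no  _ | no  _ = count-flip (P? ∘ suc) (Q? ∘ suc) v pv ¬qv λ w w≢v → P⇔Q (suc w) (w≢v ∘ Fin.suc-injective)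
... | yes p | no ¬q = ⊥-elim (¬q (Equivalence.to (P⇔Q zero λ ()) p))
... | no ¬p | yes q = ⊥-elim (¬p (Equivalence.from (P⇔Q zero λ ()) q))

count≡suc⇒∃ : ∀ {N} {P : Pred (Fin N) ℓ} (P? : Decidable P) {c : ℕ} → count P? ≡ suc c → ∃ P
count≡suc⇒∃ {N = suc N} P? eq with P? zero
... | yes p = zero , p
... | no  _ = let v , p = count≡suc⇒∃ (P? ∘ suc) eq in suc v , p

∃⇒count≡suc : ∀ {N} {P : Pred (Fin N) ℓ} (P? : Decidable P) (v : Fin N) → P v → ∃ λ c → count P? ≡ suc c
∃⇒count≡suc P? zero p with P? zero
... | yes _  = _ , refl
... | no ¬p = ⊥-elim (¬p p)
∃⇒count≡suc P? (suc v) p with P? zero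
... | yes _ = _ , refl
... | no  _ = ∃⇒count≡suc (P? ∘ suc) v p

∃⇒1≤count : ∀ {N} {P : Pred (Fin N) ℓ} (P? : Decidable P) (v : Fin N) → P v → 1 ≤ count P?
∃⇒1≤count P? v p with ∃⇒count≡suc P? v p
... | _ , eq = subst (1 ≤_) (sym eq) (s≤s z≤n)

1≤count⇒∃ : ∀ {N} {P : Pred (Fin N) ℓ} (P? : Decidable P) → 1 ≤ count P? → ∃ P
1≤count⇒∃ P? pos with count P? in eq
... | suc _ = count≡suc⇒∃ P? eq

count≡0⇒¬ : ∀ {N} {P : Pred (Fin N) ℓ} (P? : Decidable P) → count P? ≡ 0 → ∀ v → ¬ P v
count≡0⇒¬ P? eq v p with ∃⇒count≡suc P? v p
... | _ , eq′ with () ← trans (sym eq) eq′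

¬⇒count<N : ∀ {N} {P : Pred (Fin N) ℓ} (P? : Decidable P) (v : Fin N) → ¬ P v → count P? < N
¬⇒count<N P? zero ¬p with P? zero
... | yes p = ⊥-elim (¬p p)
... | no  _ = s≤s (count≤ (P? ∘ suc))
¬⇒count<N P? (suc v) ¬p with P? zero
... | yes _ = s≤s (¬⇒count<N (P? ∘ suc) v ¬p)
... | no  _ = m≤n⇒m≤1+n (¬⇒count<N (P? ∘ suc) v ¬p)

none⇒count≡0 : ∀ {N} {P : Pred (Fin N) ℓ} (P? : Decidable P) → (∀ v → ¬ P v) → count P? ≡ 0
none⇒count≡0 {N = zero}  P? ¬P = refl
none⇒count≡0 {N = suc N} P? ¬P with P? zero
... | yes p = ⊥-elim (¬P zero p)
... | no  _ = none⇒count≡0 (P? ∘ suc) (¬P ∘ suc)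

all⇒count≡N : ∀ {N} {P : Pred (Fin N) ℓ} (P? : Decidable P) → (∀ v → P v) → count P? ≡ N
all⇒count≡N {N = zero}  P? all = refl
all⇒count≡N {N = suc N} P? all with P? zero
... | yes _ = cong suc (all⇒count≡N (P? ∘ suc) (all ∘ suc))
... | no ¬p = ⊥-elim (¬p (all zero))

count-< : ∀ m n → count {N = m + n} (λ v → toℕ v <? m) ≡ m
count-< zero    n = none⇒count≡0 (λ (v : Fin n) → toℕ v <? 0) λ _ ()
count-< (suc m) n = cong suc (trans (count-cong (λ (v : Fin (m + n)) → toℕ (suc v) <? suc m) (λ v → toℕ v <? m)
                                                λ _ → mk⇔ ≤-pred s≤s)
                                    (count-< m n))

count-≮ : ∀ m n → count {N = m + n} (λ v → ¬? (toℕ v <? m)) ≡ n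
count-≮ zero    n = all⇒count≡N (λ (v : Fin n) → ¬? (toℕ v <? 0)) λ _ ()
count-≮ (suc m) n = trans (count-cong (λ (v : Fin (m + n)) → ¬? (toℕ (suc v) <? suc m)) (λ v → ¬? (toℕ v <? m))
                                      λ _ → ¬-cong-⇔ (mk⇔ ≤-pred s≤s))
                          (count-≮ m n)

-- Turns, parity and halving

opponent : Player → Player
opponent alice = bob
opponent bob   = alice

opponent-involutive : ∀ p → opponent (opponent p) ≡ p
opponent-involutive alice = refl
opponent-involutive bob   = refl

opponent≢ : ∀ p → opponent p ≢ p
opponent≢ alice ()
opponent≢ bob   ()

playerAfter : ℕ → Player → Player
playerAfter zero    p = p
playerAfter (suc r) p = playerAfter r (opponent p)

playerAfter-2+ : ∀ r p → playerAfter (2 + r) p ≡ playerAfter r p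
playerAfter-2+ r p = cong (playerAfter r) (opponent-involutive p)

playerAfter-double : ∀ h p → playerAfter (h + h) p ≡ p
playerAfter-double zero    p = refl
playerAfter-double (suc h) p = begin
  playerAfter (suc (h + suc h)) p  ≡⟨ cong (λ x → playerAfter (suc x) p) (+-suc h h) ⟩
  playerAfter (2 + (h + h)) p      ≡⟨ playerAfter-2+ (h + h) p ⟩
  playerAfter (h + h) p            ≡⟨ playerAfter-double h p ⟩
  p                                ∎
  where open ≡-Reasoning

playerAfter≡opponent⇒pos : ∀ {r} p → playerAfter r p ≡ opponent p → 1 ≤ r
playerAfter≡opponent⇒pos {zero}  p e = ⊥-elim (opponent≢ p (sym e))
playerAfter≡opponent⇒pos {suc r} p _ = s≤s z≤n

even-2+ : ∀ {r} → Even (2 + r) → Even r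
even-2+ e = ∣m+n∣m⇒∣n e ∣-refl

¬even-1 : ¬ Even 1
¬even-1 e with () ← ∣1⇒≡1 e

playerAfter-even : ∀ {n} p → Even n → playerAfter n p ≡ p
playerAfter-even {zero}        p _ = refl
playerAfter-even {suc zero}    p e = ⊥-elim (¬even-1 e)
playerAfter-even {suc (suc n)} p e = trans (playerAfter-2+ n p) (playerAfter-even p (even-2+ e))

playerAfter-odd : ∀ {n} p → ¬ Even n → playerAfter n p ≡ opponent p
playerAfter-odd {zero}        p ¬e = ⊥-elim (¬e (divides 0 refl))
playerAfter-odd {suc zero}    p _  = refl
playerAfter-odd {suc (suc n)} p ¬e = trans (playerAfter-2+ n p) (playerAfter-odd p (¬e ∘ ∣m∣n⇒∣m+n ∣-refl))

playerAfter≡self⇒even : ∀ {n} p → playerAfter n p ≡ p → Even n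
playerAfter≡self⇒even {n} p eq =
  decidable-stable (2 ∣? n) λ ¬e → opponent≢ p (trans (sym (playerAfter-odd p ¬e)) eq)

≢alice⇒≡bob : ∀ {p} → p ≢ alice → p ≡ bob
≢alice⇒≡bob {alice} p≢alice = ⊥-elim (p≢alice refl)
≢alice⇒≡bob {bob}   _       = refl

suc+suc : ∀ x y → suc x + suc y ≡ 2 + (x + y)
suc+suc x y = cong suc (+-suc x y)

⌊/2⌋-split : ∀ m → m ≡ ⌊ m /2⌋ + ⌊ m /2⌋ ⊎ m ≡ suc (⌊ m /2⌋ + ⌊ m /2⌋)
⌊/2⌋-split zero          = inj₁ refl
⌊/2⌋-split (suc zero)    = inj₂ refl
⌊/2⌋-split (suc (suc m)) = Sum.map (λ e → trans (cong (2 +_) e) (sym (suc+suc h h)))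
                                   (λ e → trans (cong (2 +_) e) (cong suc (sym (suc+suc h h))))
                                   (⌊/2⌋-split m)
  where h = ⌊ m /2⌋

⌈m+1/2⌉≡suc⌊m/2⌋ : ∀ m → ⌈ m + 1 /2⌉ ≡ suc ⌊ m /2⌋
⌈m+1/2⌉≡suc⌊m/2⌋ m = cong (λ x → ⌊ suc x /2⌋) (+-comm m 1)

⌊/2⌋-double≤ : ∀ m → ⌊ m /2⌋ + ⌊ m /2⌋ ≤ m
⌊/2⌋-double≤ m with ⌊/2⌋-split m
... | inj₁ e = ≤-reflexive (sym e)
... | inj₂ e = ≤-trans (n≤1+n _) (≤-reflexive (sym e))

≤suc-⌊/2⌋-double : ∀ m → m ≤ suc (⌊ m /2⌋ + ⌊ m /2⌋)
≤suc-⌊/2⌋-double m with ⌊/2⌋-split m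
... | inj₁ e = ≤-trans (≤-reflexive e) (n≤1+n _)
... | inj₂ e = ≤-reflexive e

even-double : ∀ h → Even (h + h)
even-double h = divides h (sym (trans (*-comm h 2) (cong (h +_) (+-identityʳ h))))

¬even-suc-double : ∀ h → ¬ Even (suc (h + h))
¬even-suc-double h e = opponent≢ alice (trans (sym (playerAfter-double h bob)) (playerAfter-even alice e))

even⇒double : ∀ {m} → Even m → m ≡ ⌊ m /2⌋ + ⌊ m /2⌋
even⇒double {m} em with ⌊/2⌋-split m
... | inj₁ e = e
... | inj₂ e = ⊥-elim (¬even-suc-double ⌊ m /2⌋ (subst Even e em))

-- The deficit 2a − r of a side with a missing colours and r uncoloured vertices, compared with d.
-- Records, unlike the bare inequalities, keep a and r inferable.

record Deficit≤ (d a r : ℕ) : Set where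
  constructor deficit≤
  field bound : a + a ≤ d + r

record Deficit≡ (d a r : ℕ) : Set where
  constructor deficit≡
  field exact : a + a ≡ d + r

record Deficit≥ (d a r : ℕ) : Set where
  constructor deficit≥
  field bound : d + r ≤ a + a

private variable
  d a b r z : ℕ

Deficit≤-weaken : Deficit≤ d a r → Deficit≤ (suc d) a r
Deficit≤-weaken (deficit≤ p) = deficit≤ (m≤n⇒m≤1+n p)

Deficit≤-waste : Deficit≤ d a (suc r) → Deficit≤ (suc d) a r
Deficit≤-waste {d} {a} {r} (deficit≤ p) = deficit≤ (subst (a + a ≤_) (+-suc d r) p)

Deficit≤-fill : Deficit≤ (suc d) (suc a) (suc r) → Deficit≤ d a r
Deficit≤-fill {d} {a} {r} (deficit≤ p) = deficit≤ (≤-pred (≤-pred (subst₂ _≤_ (suc+suc a a) (suc+suc d r) p)))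

Deficit≤-split : Deficit≤ (suc d) a r → Deficit≡ (suc d) a r ⊎ Deficit≤ d a r
Deficit≤-split (deficit≤ p) with m≤n⇒m<n∨m≡n p
... | inj₁ lt = inj₂ (deficit≤ (≤-pred lt))
... | inj₂ eq = inj₁ (deficit≡ eq)

Deficit≤⇒¬≡ : Deficit≤ d a r → ¬ Deficit≡ (suc d) a r
Deficit≤⇒¬≡ (deficit≤ p) (deficit≡ e) = <⇒≢ (s≤s p) e

Deficit≡⇒≤ : Deficit≡ d a r → Deficit≤ d a r
Deficit≡⇒≤ (deficit≡ e) = deficit≤ (≤-reflexive e)

Deficit≡⇒≥ : Deficit≡ d a r → Deficit≥ d a r
Deficit≡⇒≥ (deficit≡ e) = deficit≥ (≤-reflexive (sym e))

Deficit≡-fill : Deficit≡ (suc d) (suc a) (suc r) → Deficit≡ d a r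
Deficit≡-fill {d} {a} {r} (deficit≡ e) = deficit≡ (suc-injective (suc-injective (begin
  2 + (a + a)    ≡⟨ sym (suc+suc a a) ⟩
  suc a + suc a  ≡⟨ e ⟩
  suc d + suc r  ≡⟨ suc+suc d r ⟩
  2 + (d + r)    ∎)))
  where open ≡-Reasoning

Deficit≥-weaken : Deficit≥ (suc d) a r → Deficit≥ d a r
Deficit≥-weaken (deficit≥ p) = deficit≥ (≤-trans (n≤1+n _) p)

Deficit≥-waste : Deficit≥ d a (suc r) → Deficit≥ (suc d) a r
Deficit≥-waste {d} {a} {r} (deficit≥ p) = deficit≥ (subst (_≤ a + a) (+-suc d r) p)

Deficit≥-fill : Deficit≥ (suc d) (suc a) (suc r) → Deficit≥ d a r
Deficit≥-fill {d} {a} {r} (deficit≥ p) = deficit≥ (≤-pred (≤-pred (subst₂ _≤_ (suc+suc d r) (suc+suc a a) p)))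

Deficit≡1⇒1≤r : Deficit≡ 1 a r → 1 ≤ r
Deficit≡1⇒1≤r {zero}  {zero}  (deficit≡ ())
Deficit≡1⇒1≤r {suc a} {zero}  (deficit≡ e) with () ← suc-injective (trans (sym (suc+suc a a)) e)
Deficit≡1⇒1≤r {r = suc r} _ = s≤s z≤n

Deficit≤1⇒a≡0 : Deficit≤ 1 a 0 → a ≡ 0
Deficit≤1⇒a≡0 {zero}  _ = refl
Deficit≤1⇒a≡0 {suc a} (deficit≤ p) with s≤s () ← subst (_≤ 1) (suc+suc a a) p

Deficit≡2⇒playerAfter : ∀ {p} → Deficit≡ 2 a r → playerAfter r p ≡ p
Deficit≡2⇒playerAfter {a} {r} {p} (deficit≡ e) = begin
  playerAfter r p        ≡⟨ sym (playerAfter-2+ r p) ⟩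
  playerAfter (2 + r) p  ≡⟨ cong (λ x → playerAfter x p) (sym e) ⟩
  playerAfter (a + a) p  ≡⟨ playerAfter-double a p ⟩
  p                      ∎
  where open ≡-Reasoning

Deficit≥⇒1≤a : Deficit≥ (suc d) a r → 1 ≤ a
Deficit≥⇒1≤a {a = suc a} _ = s≤s z≤n
Deficit≥⇒1≤a {a = zero} (deficit≥ ())

Deficit≥1⇒≥2 : Deficit≥ 1 a 0 → Deficit≥ 2 a 0
Deficit≥1⇒≥2 {zero}  (deficit≥ ())
Deficit≥1⇒≥2 {suc a} _ = deficit≥ (subst (2 ≤_) (sym (suc+suc a a)) (s≤s (s≤s z≤n)))

-- The game on tallies

record Tally : Set where
  constructor ⟨_,_,_⟩
  field
    free missing present : ℕ

open Tally public

⟨⟩-cong : ∀ {r a z r′ a′ z′} → r ≡ r′ → a ≡ a′ → z ≡ z′ → ⟨ r , a , z ⟩ ≡ ⟨ r′ , a′ , z′ ⟩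
⟨⟩-cong refl refl refl = refl

data _⟶_ : Tally → Tally → Set where
  fill  : ⟨ suc r , suc a , z ⟩ ⟶ ⟨ r , a , suc z ⟩
  waste : ⟨ suc r , a , suc z ⟩ ⟶ ⟨ r , a , suc z ⟩

private variable
  p : Player
  ra rb za zb : ℕ
  tA tB : Tally

tempo : Player → ℕ
tempo alice = 1
tempo bob   = 0

-- r′ is the number of uncoloured vertices on the other side: once they are used up, playerAfter r′ p
-- has to open the fresh side.

FreshSide : Player → ℕ → ℕ → ℕ → Set
FreshSide p r a r′ = 1 ≤ r × 1 ≤ a × Deficit≤ 2 a r × (Deficit≡ 2 a r → playerAfter r′ p ≡ bob)

FreshBesideStarted : Player → ℕ → ℕ → ℕ → ℕ → Set
FreshBesideStarted p r a r′ a′ =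
  1 ≤ r × 1 ≤ a × Deficit≤ (tempo p) a′ r′ × (Deficit≤ 1 a r ⊎ (Deficit≡ 2 a r × playerAfter r′ p ≡ bob))

Winning : Player → Tally → Tally → Set
Winning p     ⟨ ra , a , zero ⟩  ⟨ rb , b , zero ⟩  = FreshSide p ra a rb × FreshSide p rb b ra
Winning p     ⟨ ra , a , zero ⟩  ⟨ rb , b , suc _ ⟩ = FreshBesideStarted p ra a rb b
Winning p     ⟨ ra , a , suc _ ⟩ ⟨ rb , b , zero ⟩  = FreshBesideStarted p rb b ra a
Winning alice ⟨ ra , a , suc _ ⟩ ⟨ rb , b , suc _ ⟩ =
  Deficit≤ 1 a ra × Deficit≤ 1 b rb × ¬ (Deficit≡ 1 a ra × Deficit≡ 1 b rb)
Winning bob   ⟨ ra , a , suc _ ⟩ ⟨ rb , b , suc _ ⟩ = Deficit≤ 0 a ra × Deficit≤ 0 b rb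

Winning-swap : ∀ p tA tB → Winning p tA tB → Winning p tB tA
Winning-swap p     ⟨ _ , _ , zero ⟩  ⟨ _ , _ , zero ⟩  (wa , wb) = wb , wa
Winning-swap p     ⟨ _ , _ , zero ⟩  ⟨ _ , _ , suc _ ⟩ w = w
Winning-swap p     ⟨ _ , _ , suc _ ⟩ ⟨ _ , _ , zero ⟩  w = w
Winning-swap alice ⟨ _ , _ , suc _ ⟩ ⟨ _ , _ , suc _ ⟩ (δa , δb , ¬tight) = δb , δa , λ (tb , ta) → ¬tight (ta , tb)
Winning-swap bob   ⟨ _ , _ , suc _ ⟩ ⟨ _ , _ , suc _ ⟩ (δa , δb) = δb , δa

fresh-status : ∀ {X : Set} → Deficit≤ 2 a r → (Deficit≡ 2 a r → X) → Deficit≤ 1 a r ⊎ (Deficit≡ 2 a r × X)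
fresh-status δ tight⇒x with Deficit≤-split δ
... | inj₁ tight = inj₂ (tight , tight⇒x tight)
... | inj₂ δ₁    = inj₁ δ₁

fresh-status⇒Deficit≤2 : ∀ {X : Set} → Deficit≤ 1 a r ⊎ (Deficit≡ 2 a r × X) → Deficit≤ 2 a r
fresh-status⇒Deficit≤2 (inj₁ δ)         = Deficit≤-weaken δ
fresh-status⇒Deficit≤2 (inj₂ (tight , _)) = Deficit≡⇒≤ tight

Deficit≤-after-move : ∀ {t} → Deficit≤ 0 a r → ⟨ r , a , suc z ⟩ ⟶ t → Deficit≤ 1 (missing t) (free t)
Deficit≤-after-move δ fill  = Deficit≤-weaken (Deficit≤-fill (Deficit≤-weaken δ))
Deficit≤-after-move δ waste = Deficit≤-waste δ

Winning-after-bob-A : ∀ tA tB {tA′} → Winning bob tA tB → tA ⟶ tA′ → Winning alice tA′ tB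
Winning-after-bob-A ⟨ _ , _ , zero ⟩ ⟨ _ , _ , zero ⟩ ((_ , _ , δa , _) , (rb≥1 , b≥1 , δb , tightB)) fill =
  rb≥1 , b≥1 , Deficit≤-fill δa , fresh-status δb tightB
Winning-after-bob-A ⟨ _ , _ , zero ⟩ ⟨ _ , _ , suc _ ⟩ (_ , _ , δb , status) fill =
  Deficit≤-fill (fresh-status⇒Deficit≤2 status) , Deficit≤-weaken δb , λ (_ , tb) → Deficit≤⇒¬≡ δb tb
Winning-after-bob-A ⟨ _ , _ , suc _ ⟩ ⟨ _ , _ , zero ⟩ (rb≥1 , b≥1 , δa , status) mv@fill =
  rb≥1 , b≥1 , Deficit≤-after-move δa mv , status
Winning-after-bob-A ⟨ _ , _ , suc _ ⟩ ⟨ _ , _ , zero ⟩ (rb≥1 , b≥1 , δa , status) mv@waste =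
  rb≥1 , b≥1 , Deficit≤-after-move δa mv , status
Winning-after-bob-A ⟨ _ , _ , suc _ ⟩ ⟨ _ , _ , suc _ ⟩ (δa , δb) mv@fill =
  Deficit≤-after-move δa mv , Deficit≤-weaken δb , λ (_ , tb) → Deficit≤⇒¬≡ δb tb
Winning-after-bob-A ⟨ _ , _ , suc _ ⟩ ⟨ _ , _ , suc _ ⟩ (δa , δb) mv@waste =
  Deficit≤-after-move δa mv , Deficit≤-weaken δb , λ (_ , tb) → Deficit≤⇒¬≡ δb tb

Winning-after-bob-B : ∀ tA tB {tB′} → Winning bob tA tB → tB ⟶ tB′ → Winning alice tA tB′
Winning-after-bob-B tA tB {tB′} w mv =
  Winning-swap alice tB′ tA (Winning-after-bob-A tB tA (Winning-swap bob tA tB w) mv)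

winning-finished : ∀ p tA tB → free tA ≡ 0 → free tB ≡ 0 → Winning p tA tB → missing tA ≡ 0 × missing tB ≡ 0
winning-finished p     ⟨ _ , _ , zero ⟩  ⟨ _ , _ , zero ⟩  refl refl ((() , _) , _)
winning-finished p     ⟨ _ , _ , zero ⟩  ⟨ _ , _ , suc _ ⟩ refl refl (() , _)
winning-finished p     ⟨ _ , _ , suc _ ⟩ ⟨ _ , _ , zero ⟩  refl refl (() , _)
winning-finished alice ⟨ _ , _ , suc _ ⟩ ⟨ _ , _ , suc _ ⟩ refl refl (δa , δb , _) =
  Deficit≤1⇒a≡0 δa , Deficit≤1⇒a≡0 δb
winning-finished bob   ⟨ _ , _ , suc _ ⟩ ⟨ _ , _ , suc _ ⟩ refl refl (δa , δb) =
  Deficit≤1⇒a≡0 (Deficit≤-weaken δa) , Deficit≤1⇒a≡0 (Deficit≤-weaken δb)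

Reach : Tally → (Tally → Set) → Set
Reach t P = ∃ λ t′ → t ⟶ t′ × P t′

AliceReply : Tally → Tally → Set
AliceReply tA tB = Reach tA (λ tA′ → Winning bob tA′ tB) ⊎ Reach tB (λ tB′ → Winning bob tA tB′)

AliceReply-swap : AliceReply tB tA → AliceReply tA tB
AliceReply-swap {tB} {tA} (inj₁ (tB′ , mv , w)) = inj₂ (tB′ , mv , Winning-swap bob tB′ tA w)
AliceReply-swap {tB} {tA} (inj₂ (tA′ , mv , w)) = inj₁ (tA′ , mv , Winning-swap bob tB tA′ w)

settle : Deficit≤ 1 a (suc r) → ∃₂ λ a′ z′ → ⟨ suc r , a , suc z ⟩ ⟶ ⟨ r , a′ , suc z′ ⟩ × Deficit≤ 0 a′ r
settle {zero}  _ = _ , _ , waste , deficit≤ z≤n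
settle {suc a} δ = _ , _ , fill , Deficit≤-fill δ

settle-A : 1 ≤ ra → Deficit≤ 1 a ra → Deficit≤ 0 b rb → AliceReply ⟨ ra , a , suc za ⟩ ⟨ rb , b , suc zb ⟩
settle-A (s≤s z≤n) δa δb₀ with settle δa
... | _ , _ , mv , δa′ = inj₁ (_ , mv , δa′ , δb₀)

reply-started : 1 ≤ ra ⊎ 1 ≤ rb → Deficit≤ 1 a ra → Deficit≤ 1 b rb → ¬ (Deficit≡ 1 a ra × Deficit≡ 1 b rb) →
                AliceReply ⟨ ra , a , suc za ⟩ ⟨ rb , b , suc zb ⟩
reply-started R δa δb ¬tight with Deficit≤-split δa | Deficit≤-split δb
... | inj₁ ta  | inj₁ tb  = ⊥-elim (¬tight (ta , tb))
... | inj₁ ta  | inj₂ δb₀ = settle-A (Deficit≡1⇒1≤r ta) δa δb₀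
... | inj₂ δa₀ | inj₁ tb  = AliceReply-swap (settle-A (Deficit≡1⇒1≤r tb) δb δa₀)
... | inj₂ δa₀ | inj₂ δb₀ with R
...   | inj₁ ra≥1 = settle-A ra≥1 δa δb₀
...   | inj₂ rb≥1 = AliceReply-swap (settle-A rb≥1 δb δa₀)

settle-B : 1 ≤ ra → 1 ≤ a → 1 ≤ rb → Deficit≤ 1 b rb →
           Deficit≤ 1 a ra ⊎ (Deficit≡ 2 a ra × playerAfter rb alice ≡ bob) →
           AliceReply ⟨ ra , a , zero ⟩ ⟨ rb , b , suc zb ⟩
settle-B ra≥1 a≥1 (s≤s z≤n) δb status with settle δb
... | _ , _ , mv , δb′ = inj₂ (_ , mv , ra≥1 , a≥1 , δb′ , status)

reply-fresh-started : FreshBesideStarted alice ra a rb b → AliceReply ⟨ ra , a , zero ⟩ ⟨ rb , b , suc zb ⟩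
reply-fresh-started (ra≥1 , a≥1 , δb , status@(inj₂ (_ , after))) =
  settle-B ra≥1 a≥1 (playerAfter≡opponent⇒pos alice after) δb status
reply-fresh-started (ra≥1@(s≤s _) , a≥1@(s≤s _) , δb , status@(inj₁ δa)) with Deficit≤-split δb
... | inj₁ tb  = settle-B ra≥1 a≥1 (Deficit≡1⇒1≤r tb) δb status
... | inj₂ δb₀ = inj₁ (_ , fill , Deficit≤-fill δa , δb₀)

reply-fresh : FreshSide alice ra a rb → FreshSide alice rb b ra → AliceReply ⟨ ra , a , zero ⟩ ⟨ rb , b , zero ⟩
reply-fresh (ra≥1@(s≤s _) , a≥1@(s≤s _) , δa , tightA) (rb≥1@(s≤s _) , b≥1@(s≤s _) , δb , tightB)
  with Deficit≤-split δa
... | inj₂ δa₁ = inj₁ (_ , fill , rb≥1 , b≥1 , Deficit≤-fill δa₁ , fresh-status δb tightB)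
... | inj₁ ta with fresh-status δb tightB
...   | inj₁ δb₁      = inj₂ (_ , fill , ra≥1 , a≥1 , Deficit≤-fill δb₁ , inj₂ (ta , tightA ta))
...   | inj₂ (tb , _) = ⊥-elim (opponent≢ alice (trans (sym (tightA ta)) (Deficit≡2⇒playerAfter tb)))

alice-reply : ∀ tA tB → Winning alice tA tB → 1 ≤ free tA ⊎ 1 ≤ free tB → AliceReply tA tB
alice-reply ⟨ _ , _ , zero ⟩  ⟨ _ , _ , zero ⟩  (wa , wb) _ = reply-fresh wa wb
alice-reply ⟨ _ , _ , zero ⟩  ⟨ _ , _ , suc _ ⟩ w _ = reply-fresh-started w
alice-reply ⟨ _ , _ , suc _ ⟩ ⟨ _ , _ , zero ⟩  w _ = AliceReply-swap (reply-fresh-started w)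
alice-reply ⟨ _ , _ , suc _ ⟩ ⟨ _ , _ , suc _ ⟩ (δa , δb , ¬tight) R = reply-started R δa δb ¬tight

-- Bob only watches side A; rb is the number of uncoloured vertices of B.

Losing : Player → Tally → ℕ → Set
Losing p ⟨ ra , a , zero ⟩  rb = Deficit≥ 3 a ra ⊎ (Deficit≡ 2 a ra × playerAfter rb p ≡ alice)
Losing p ⟨ ra , a , suc _ ⟩ rb = Deficit≥ (suc (tempo p)) a ra

Losing⇒1≤missing : ∀ p tA rb → Losing p tA rb → 1 ≤ missing tA
Losing⇒1≤missing p ⟨ _ , _ , zero ⟩  _ (inj₁ δ)       = Deficit≥⇒1≤a δ
Losing⇒1≤missing p ⟨ _ , _ , zero ⟩  _ (inj₂ (t , _)) = Deficit≥⇒1≤a (Deficit≡⇒≥ t)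
Losing⇒1≤missing p ⟨ _ , _ , suc _ ⟩ _ δ              = Deficit≥⇒1≤a δ

Losing-after-alice-A : ∀ tA {tA′} → Losing alice tA rb → tA ⟶ tA′ → Losing bob tA′ rb
Losing-after-alice-A ⟨ _ , _ , zero ⟩  (inj₁ δ)       fill  = Deficit≥-weaken (Deficit≥-fill δ)
Losing-after-alice-A ⟨ _ , _ , zero ⟩  (inj₂ (t , _)) fill  = Deficit≡⇒≥ (Deficit≡-fill t)
Losing-after-alice-A ⟨ _ , _ , suc _ ⟩ δ              fill  = Deficit≥-fill δ
Losing-after-alice-A ⟨ _ , _ , suc _ ⟩ δ              waste = Deficit≥-weaken (Deficit≥-weaken (Deficit≥-waste δ))

Losing-after-alice-B : ∀ tA → Losing alice tA (suc rb) → Losing bob tA rb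
Losing-after-alice-B ⟨ _ , _ , zero ⟩  l = l
Losing-after-alice-B ⟨ _ , _ , suc _ ⟩ δ = Deficit≥-weaken δ

CanWaste : Tally → Set
CanWaste t = 1 ≤ free t × 1 ≤ present t

data BobReply (tA : Tally) (rb : ℕ) : Set where
  on-A : ∀ {tA′} → CanWaste tA ⊎ rb ≡ 0 → tA ⟶ tA′ → Losing alice tA′ rb → BobReply tA rb
  on-B : ∀ {rb′} → ¬ CanWaste tA → rb ≡ suc rb′ → Losing alice tA rb′ → BobReply tA rb

-- Bob wastes on A when he can, otherwise plays on B, and fills A only once B is full.
bob-reply : ∀ tA rb → Losing bob tA rb → 1 ≤ free tA ⊎ 1 ≤ rb → BobReply tA rb
bob-reply ⟨ suc _ , _ , suc _ ⟩ _       δ _ = on-A (inj₁ (s≤s z≤n , s≤s z≤n)) waste (Deficit≥-waste δ)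
bob-reply ⟨ zero  , _ , suc _ ⟩ (suc _) δ _ = on-B (λ ()) refl (Deficit≥1⇒≥2 δ)
bob-reply ⟨ zero  , _ , suc _ ⟩ zero    _ (inj₁ ())
bob-reply ⟨ zero  , _ , suc _ ⟩ zero    _ (inj₂ ())
bob-reply ⟨ _     , _ , zero ⟩  (suc _) l _ = on-B (λ ()) refl l
bob-reply ⟨ _     , _ , zero ⟩  zero    (inj₂ (_ , ())) _
bob-reply ⟨ zero  , _ , zero ⟩  zero    (inj₁ _) (inj₁ ())
bob-reply ⟨ zero  , _ , zero ⟩  zero    (inj₁ _) (inj₂ ())
bob-reply ⟨ suc _ , zero  , zero ⟩ zero (inj₁ (deficit≥ ())) _
bob-reply ⟨ suc _ , suc _ , zero ⟩ zero (inj₁ δ) _ = on-A (inj₂ refl) fill (Deficit≥-fill δ)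

Losing-alice-waste⇒missing≥2 : ∀ t → Losing alice t r → CanWaste t → 2 ≤ missing t
Losing-alice-waste⇒missing≥2 ⟨ zero  , _ , _ ⟩ _ (() , _)
Losing-alice-waste⇒missing≥2 ⟨ _ , _ , zero ⟩ _ (_ , ())
Losing-alice-waste⇒missing≥2 ⟨ suc _ , zero , suc _ ⟩ (deficit≥ ()) _
Losing-alice-waste⇒missing≥2 ⟨ suc _ , suc zero , suc _ ⟩ (deficit≥ (s≤s (s≤s ()))) _
Losing-alice-waste⇒missing≥2 ⟨ suc _ , suc (suc _) , suc _ ⟩ _ _ = s≤s (s≤s z≤n)

-- Colourings of K m n

module Colouring (m n k : ℕ) where

  V : Set
  V = Fin (m + n)

  Pos : Set
  Pos = Position (K m n) k

  InA InB : Pred V 0ℓ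
  InA v = toℕ v < m
  InB v = ¬ InA v

  inA? : Decidable InA
  inA? v = toℕ v <? m

  inB? : Decidable InB
  inB? v = ¬? (inA? v)

  _≟ᶜ_ : DecidableEquality (Maybe (Fin k))
  _≟ᶜ_ = Maybe.≡-dec Fin._≟_

  blank? : (c : Pos) → Decidable (λ v → c v ≡ nothing)
  blank? c v = c v ≟ᶜ nothing

  Shows : Pred V 0ℓ → Pos → Fin k → Set
  Shows S c i = ∃ λ v → S v × c v ≡ just i

  shows? : {S : Pred V 0ℓ} → Decidable S → (c : Pos) → Decidable (Shows S c)
  shows? S? c i = Fin.any? λ v → S? v ×-dec (c v ≟ᶜ just i)

  free? : {S : Pred V 0ℓ} → Decidable S → (c : Pos) → Decidable (λ v → S v × c v ≡ nothing)
  free? S? c v = S? v ×-dec (c v ≟ᶜ nothing)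

  tally : {S : Pred V 0ℓ} → Decidable S → Pos → Tally
  tally S? c = ⟨ count (free? S? c) , count (¬? ∘ shows? S? c) , count (shows? S? c) ⟩

  freeCount : Pos → ℕ
  freeCount c = count (blank? c)

  _[_≔_] : Pos → V → Fin k → Pos
  c [ v ≔ i ] = assign {K m n} c v i

  private variable
    c : Pos
    v w : V
    i j : Fin k
    S : Pred V 0ℓ

  assign-here : ∀ c v i → (c [ v ≔ i ]) v ≡ just i
  assign-here c v i with v Fin.≟ v
  ... | yes _   = refl
  ... | no v≢v = ⊥-elim (v≢v refl)

  assign-elsewhere : ∀ c v i → w ≢ v → (c [ v ≔ i ]) w ≡ c w
  assign-elsewhere {w} c v i w≢v with w Fin.≟ v
  ... | yes w≡v = ⊥-elim (w≢v w≡v)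
  ... | no  _   = refl

  assign-elsewhere-⇔ : ∀ c v i {A : Set} {x} → w ≢ v → (A × c w ≡ x) ⇔ (A × (c [ v ≔ i ]) w ≡ x)
  assign-elsewhere-⇔ c v i w≢v = mk⇔ (λ (a , e) → a , trans (assign-elsewhere c v i w≢v) e)
                                     (λ (a , e) → a , trans (sym (assign-elsewhere c v i w≢v)) e)

  assigned≢nothing : ∀ c v i → (c [ v ≔ i ]) v ≢ nothing
  assigned≢nothing c v i e with () ← trans (sym (assign-here c v i)) e

  coloured≢free : c v ≡ nothing → c w ≡ just j → w ≢ v
  coloured≢free cv cw refl with () ← trans (sym cv) cw

  Shows-assign : c v ≡ nothing → Shows S c j → Shows S (c [ v ≔ i ]) j
  Shows-assign {c = c} {v = v} {i = i} cv (w , Sw , cw) =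
    w , Sw , trans (assign-elsewhere c v i (coloured≢free cv cw)) cw

  Shows-assign-new : S v → Shows S (c [ v ≔ i ]) i
  Shows-assign-new {v = v} {c = c} {i = i} Sv = v , Sv , assign-here c v i

  -- The hypothesis holds when v lies outside S, when j ≢ i, or when colour i already shows on S.
  Shows-assign⁻ : (S v → j ≡ i → Shows S c i) → Shows S (c [ v ≔ i ]) j → Shows S c j
  -- `assign` is defined by the same `with`, so it also reduces the type of cw.
  Shows-assign⁻ {v = v} back (w , Sw , cw) with w Fin.≟ v
  ... | no  _    = w , Sw , cw
  ... | yes refl = subst (Shows _ _) (sym j≡i) (back Sw j≡i)
    where j≡i = sym (Maybe.just-injective cw)

  Shows-assign-⇔ : c v ≡ nothing → (S v → j ≡ i → Shows S c i) → Shows S (c [ v ≔ i ]) j ⇔ Shows S c j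
  Shows-assign-⇔ cv back = mk⇔ (Shows-assign⁻ back) (Shows-assign cv)

  module _ {S : Pred V 0ℓ} (S? : Decidable S) {c : Pos} {v : V} {i : Fin k} (cv : c v ≡ nothing) where

    private
      c′ = c [ v ≔ i ]

    tally-outside : ¬ S v → tally S? c′ ≡ tally S? c
    tally-outside ¬Sv = ⟨⟩-cong free≡
      (count-cong (¬? ∘ shows? S? c′) (¬? ∘ shows? S? c) (¬-cong-⇔ ∘ shows⇔))
      (count-cong (shows? S? c′) (shows? S? c) shows⇔)
      where
      away : ∀ {w} → S w → w ≢ v
      away Sw refl = ¬Sv Sw
      free≡ : free (tally S? c′) ≡ free (tally S? c)
      free≡ = count-cong (free? S? c′) (free? S? c) λ _ →
        mk⇔ (λ (Sw , e) → Sw , trans (sym (assign-elsewhere c v i (away Sw))) e)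
            (λ (Sw , e) → Sw , trans (assign-elsewhere c v i (away Sw)) e)
      shows⇔ : ∀ j → Shows S c′ j ⇔ Shows S c j
      shows⇔ j = Shows-assign-⇔ cv λ Sv → ⊥-elim (¬Sv Sv)

    module _ (Sv : S v) where

      free-inside : free (tally S? c) ≡ suc (free (tally S? c′))
      free-inside = count-flip (free? S? c) (free? S? c′) v (Sv , cv) (assigned≢nothing c v i ∘ proj₂)
                               λ w w≢v → assign-elsewhere-⇔ c v i w≢v

      tally-fill : ¬ Shows S c i → tally S? c ≡ ⟨ suc r , suc a , z ⟩ → tally S? c′ ≡ ⟨ r , a , suc z ⟩
      tally-fill ¬shown e = ⟨⟩-cong
        (suc-injective (trans (sym free-inside) (cong free e)))
        (suc-injective (trans (sym missing≡) (cong missing e)))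
        (trans present≡ (cong (suc ∘ present) e))
        where
        shows⇔ : ∀ j → j ≢ i → Shows S c′ j ⇔ Shows S c j
        shows⇔ j j≢i = Shows-assign-⇔ cv λ _ j≡i → ⊥-elim (j≢i j≡i)
        missing≡ : missing (tally S? c) ≡ suc (missing (tally S? c′))
        missing≡ = count-flip (¬? ∘ shows? S? c) (¬? ∘ shows? S? c′) i ¬shown
                     (λ ¬shown′ → ¬shown′ (Shows-assign-new Sv)) λ j j≢i → ¬-cong-⇔ (⇔.sym (shows⇔ j j≢i))
        present≡ : present (tally S? c′) ≡ suc (present (tally S? c))
        present≡ = count-flip (shows? S? c′) (shows? S? c) i (Shows-assign-new Sv) ¬shown shows⇔

      tally-waste : Shows S c i → tally S? c ≡ ⟨ suc r , a , suc z ⟩ → tally S? c′ ≡ ⟨ r , a , suc z ⟩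
      tally-waste shown e = ⟨⟩-cong
        (suc-injective (trans (sym free-inside) (cong free e)))
        (trans (count-cong (¬? ∘ shows? S? c′) (¬? ∘ shows? S? c) (¬-cong-⇔ ∘ shows⇔)) (cong missing e))
        (trans (count-cong (shows? S? c′) (shows? S? c) shows⇔) (cong present e))
        where
        shows⇔ : ∀ j → Shows S c′ j ⇔ Shows S c j
        shows⇔ j = Shows-assign-⇔ cv λ _ _ → shown

      tally-step : tally S? c ⟶ tally S? c′
      tally-step with shows? S? c i
      ... | yes shown = subst₂ _⟶_ (sym e) (sym (tally-waste shown e)) waste
        where e = ⟨⟩-cong free-inside refl (proj₂ (∃⇒count≡suc (shows? S? c) i shown))
      ... | no ¬shown = subst₂ _⟶_ (sym e) (sym (tally-fill ¬shown e)) fill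
        where e = ⟨⟩-cong free-inside (proj₂ (∃⇒count≡suc (¬? ∘ shows? S? c) i ¬shown)) refl

  realise : ∀ {S : Pred V 0ℓ} (S? : Decidable S) {c t t′} → tally S? c ≡ t → t ⟶ t′ →
            ∃₂ λ v i → c v ≡ nothing × S v × tally S? (c [ v ≔ i ]) ≡ t′
  realise S? {c} e fill
    with count≡suc⇒∃ (free? S? c) (cong free e) | count≡suc⇒∃ (¬? ∘ shows? S? c) (cong missing e)
  ... | v , Sv , cv | i , ¬shown = v , i , cv , Sv , tally-fill S? cv Sv ¬shown e
  realise S? {c} e waste
    with count≡suc⇒∃ (free? S? c) (cong free e) | count≡suc⇒∃ (shows? S? c) (cong present e)
  ... | v , Sv , cv | i , shown = v , i , cv , Sv , tally-waste S? cv Sv shown e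

  freeCount-assign : ∀ {R} → c v ≡ nothing → freeCount c ≡ suc R → freeCount (c [ v ≔ i ]) ≡ R
  freeCount-assign {c = c} {v = v} {i = i} cv eq = suc-injective (trans (sym decrease) eq)
    where
    decrease : freeCount c ≡ suc (freeCount (c [ v ≔ i ]))
    decrease = count-flip (blank? c) (blank? (c [ v ≔ i ])) v cv (assigned≢nothing c v i)
                 λ w w≢v → mk⇔ (trans (assign-elsewhere c v i w≢v)) (trans (sym (assign-elsewhere c v i w≢v)))

  free-side : c v ≡ nothing → 1 ≤ free (tally inA? c) ⊎ 1 ≤ free (tally inB? c)
  free-side {c = c} {v = v} cv with inA? v
  ... | yes v∈A = inj₁ (∃⇒1≤count (free? inA? c) v (v∈A , cv))
  ... | no  v∉A = inj₂ (∃⇒1≤count (free? inB? c) v (v∉A , cv))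

  freeCount≡0⇒Complete : freeCount c ≡ 0 → Complete {K m n} c
  freeCount≡0⇒Complete {c = c} none v with c v in cv
  ... | just _  = just tt
  ... | nothing = ⊥-elim (count≡0⇒¬ (blank? c) none v cv)

  freeCount≡0⇒free≡0 : ∀ {S : Pred V 0ℓ} (S? : Decidable S) → freeCount c ≡ 0 → free (tally S? c) ≡ 0
  freeCount≡0⇒free≡0 {c = c} S? none =
    none⇒count≡0 (free? S? c) λ v (_ , cv) → count≡0⇒¬ (blank? c) none v cv

  missing≡0⇒Shows : ∀ {S : Pred V 0ℓ} (S? : Decidable S) → missing (tally S? c) ≡ 0 → ∀ i → Shows S c i
  missing≡0⇒Shows {c = c} S? none i =
    decidable-stable (shows? S? c i) (count≡0⇒¬ (¬? ∘ shows? S? c) none i)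

  all-shown⇒dominating : missing (tally inA? c) ≡ 0 → missing (tally inB? c) ≡ 0 →
                         AllClassesDominating {K m n} c
  all-shown⇒dominating noneA noneB x i with inA? x
  ... | yes x∈A = let y , y∈B , cy = missing≡0⇒Shows inB? noneB i in y , inj₂ (inj₁ (x∈A , y∈B)) , cy
  ... | no  x∉A = let y , y∈A , cy = missing≡0⇒Shows inA? noneA i in y , inj₂ (inj₂ (x∉A , y∈A)) , cy

  empty : Pos
  empty = emptyPos (K m n) k

  tally-empty : ∀ {S : Pred V 0ℓ} (S? : Decidable S) → tally S? empty ≡ ⟨ count S? , k , 0 ⟩
  tally-empty S? = ⟨⟩-cong (count-cong (free? S? empty) S? λ _ → mk⇔ proj₁ (_, refl))
                           (all⇒count≡N (¬? ∘ shows? S? empty) λ { _ (_ , _ , ()) })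
                           (none⇒count≡0 (shows? S? empty) λ { _ (_ , _ , ()) })

  tallyA-empty : tally inA? empty ≡ ⟨ m , k , 0 ⟩
  tallyA-empty = trans (tally-empty inA?) (cong ⟨_, k , 0 ⟩ (count-< m n))

  tallyB-empty : tally inB? empty ≡ ⟨ n , k , 0 ⟩
  tallyB-empty = trans (tally-empty inB?) (cong ⟨_, k , 0 ⟩ (count-≮ m n))

-- Alice's strategy

module AliceStrategy (m n k : ℕ) where

  open Colouring m n k

  alice-wins : ∀ R p c → freeCount c ≡ R → Winning p (tally inA? c) (tally inB? c) → AliceWins (K m n) k p c
  alice-wins zero p c none w = finished (freeCount≡0⇒Complete none) (uncurry all-shown⇒dominating all-shown)
    where all-shown = winning-finished p _ _ (freeCount≡0⇒free≡0 inA? none) (freeCount≡0⇒free≡0 inB? none) w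
  alice-wins (suc R) alice c some w with count≡suc⇒∃ (blank? c) some
  ... | _ , cv₀ with alice-reply _ _ w (free-side cv₀)
  ...   | inj₁ (_ , mv , w′) with realise inA? refl mv
  ...     | v , i , cv , v∈A , eA = aliceMove v i cv (alice-wins R bob _ (freeCount-assign cv some)
              (subst₂ (Winning bob) (sym eA) (sym (tally-outside inB? cv λ v∉A → v∉A v∈A)) w′))
  alice-wins (suc R) alice c some w | _ , cv₀ | inj₂ (_ , mv , w′) with realise inB? refl mv
  ...     | v , i , cv , v∈B , eB = aliceMove v i cv (alice-wins R bob _ (freeCount-assign cv some)
              (subst₂ (Winning bob) (sym (tally-outside inA? cv v∈B)) (sym eB) w′))
  alice-wins (suc R) bob c some w = bobMove (count≡suc⇒∃ (blank? c) some)
    λ v i cv → alice-wins R alice _ (freeCount-assign cv some) (after-bob cv)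
    where
    after-bob : ∀ {v i} → c v ≡ nothing → Winning alice (tally inA? (c [ v ≔ i ])) (tally inB? (c [ v ≔ i ]))
    after-bob {v} {i} cv with inA? v
    ... | yes v∈A = subst (Winning alice _) (sym (tally-outside inB? cv λ v∉A → v∉A v∈A))
                          (Winning-after-bob-A _ _ w (tally-step inA? cv v∈A))
    ... | no  v∉A = subst (λ t → Winning alice t (tally inB? (c [ v ≔ i ]))) (sym (tally-outside inA? cv v∉A))
                          (Winning-after-bob-B _ _ w (tally-step inB? cv v∉A))

-- Bob's strategy

other-colour : ∀ {k} → 2 ≤ k → (j : Fin k) → ∃ λ j′ → j ≢ j′
other-colour (s≤s (s≤s _)) zero    = suc zero , λ ()
other-colour (s≤s (s≤s _)) (suc _) = zero , λ ()

two-others : ∀ {k} → 3 ≤ k → (i : Fin k) → ∃₂ λ j₁ j₂ → j₁ ≢ i × j₂ ≢ i × j₁ ≢ j₂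
two-others (s≤s (s≤s (s≤s _))) zero          = suc zero , suc (suc zero) , (λ ()) , (λ ()) , (λ ())
two-others (s≤s (s≤s (s≤s _))) (suc zero)    = zero , suc (suc zero) , (λ ()) , (λ ()) , (λ ())
two-others (s≤s (s≤s (s≤s _))) (suc (suc _)) = zero , suc zero , (λ ()) , (λ ()) , (λ ())

reserve : Player → ℕ
reserve alice = 2
reserve bob   = 3

module BobStrategy (m n k : ℕ) where

  open Colouring m n k

  private variable
    c : Pos
    v : V
    i j : Fin k

  freeB : Pos → ℕ
  freeB c = free (tally inB? c)

  -- For k = 2 Alice also wins when B is monochromatic in the colour missing on A.  An obstructed
  -- position rules this out for good; Reserve says that Bob can still obstruct in time.

  Obstructed : Pos → Set
  Obstructed c = ∃ λ j → Shows InB c j × (Shows InA c j ⊎ ∃ λ j′ → j ≢ j′ × Shows InB c j′)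

  Obstructible : Pos → Set
  Obstructible c = ∃ (Shows InA c) ⊎ ∃ (Shows InB c)

  Reserve : Player → Pos → Set
  Reserve alice c = Obstructed c ⊎ 2 ≤ freeB c
  Reserve bob   c = Obstructed c ⊎ 3 ≤ freeB c ⊎ (2 ≤ freeB c × Obstructible c)
                    ⊎ (1 ≤ freeB c × Obstructible c × ¬ CanWaste (tally inA? c))

  Guard : Player → Pos → Set
  Guard p c = 3 ≤ k ⊎ (k ≡ 2 × Reserve p c)

  BobWinning : Player → Pos → Set
  BobWinning p c = Losing p (tally inA? c) (freeB c) × Guard p c

  Reserve-initial : ∀ p → reserve p ≤ freeB c → Reserve p c
  Reserve-initial alice two   = inj₂ two
  Reserve-initial bob   three = inj₂ (inj₁ three)

  Obstructed-assign : c v ≡ nothing → Obstructed c → Obstructed (c [ v ≔ i ])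
  Obstructed-assign cv (j , shownB , inj₁ shownA) = j , Shows-assign cv shownB , inj₁ (Shows-assign cv shownA)
  Obstructed-assign cv (j , shownB , inj₂ (j′ , j≢j′ , shownB′)) =
    j , Shows-assign cv shownB , inj₂ (j′ , j≢j′ , Shows-assign cv shownB′)

  Reserve⇒Obstructed⊎free : ∀ p → Reserve p c → Obstructed c ⊎ 1 ≤ freeB c
  Reserve⇒Obstructed⊎free alice (inj₁ obstructed)                 = inj₁ obstructed
  Reserve⇒Obstructed⊎free alice (inj₂ two)                        = inj₂ (≤-trans (s≤s z≤n) two)
  Reserve⇒Obstructed⊎free bob   (inj₁ obstructed)                 = inj₁ obstructed
  Reserve⇒Obstructed⊎free bob   (inj₂ (inj₁ three))               = inj₂ (≤-trans (s≤s z≤n) three)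
  Reserve⇒Obstructed⊎free bob   (inj₂ (inj₂ (inj₁ (two , _))))    = inj₂ (≤-trans (s≤s z≤n) two)
  Reserve⇒Obstructed⊎free bob   (inj₂ (inj₂ (inj₂ (one , _))))    = inj₂ one

  B-monochrome : AllClassesDominating {K m n} c → ¬ Shows InA c i → InB v → c v ≡ just i
  B-monochrome {i = i} {v = v} dom ¬shown v∈B with dom v i
  ... | _ , inj₁ refl , cy                  = cy
  ... | _ , inj₂ (inj₁ (v∈A , _)) , _       = ⊥-elim (v∈B v∈A)
  ... | y , inj₂ (inj₂ (_ , y∈A)) , cy      = ⊥-elim (¬shown (y , y∈A , cy))

  A-vertex-colour : AllClassesDominating {K m n} c → ¬ Shows InA c i → InA v → j ≢ i → c v ≡ just j
  A-vertex-colour {v = v} {j = j} dom ¬shown v∈A j≢i with dom v j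
  ... | _ , inj₁ refl , cv                  = cv
  ... | _ , inj₂ (inj₁ (_ , y∈B)) , cy      =
    ⊥-elim (j≢i (Maybe.just-injective (trans (sym cy) (B-monochrome dom ¬shown y∈B))))
  ... | _ , inj₂ (inj₂ (v∉A , _)) , _       = ⊥-elim (v∉A v∈A)

  Obstructed⇒¬dominating : AllClassesDominating {K m n} c → ¬ Shows InA c i → ¬ Obstructed c
  Obstructed⇒¬dominating dom ¬shown (j , (y , y∈B , cy) , rest)
    with refl ← Maybe.just-injective (trans (sym cy) (B-monochrome dom ¬shown y∈B)) with rest
  ... | inj₁ shownA = ¬shown shownA
  ... | inj₂ (_ , j≢j′ , (y′ , y′∈B , cy′)) =
    j≢j′ (Maybe.just-injective (trans (sym (B-monochrome dom ¬shown y′∈B)) cy′))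

  complete⇒¬free : Complete {K m n} c → c v ≢ nothing
  complete⇒¬free {c = c} {v = v} comp cv with c v | comp v
  ... | just _ | _ with () ← cv

  BobWinning⇒¬finished : ∀ p {x₀} → InA x₀ → Complete {K m n} c → AllClassesDominating {K m n} c →
                          BobWinning p c → ⊥
  BobWinning⇒¬finished {c = c} p x₀∈A comp dom (losing , guard)
    with 1≤count⇒∃ (¬? ∘ shows? inA? c) (Losing⇒1≤missing p _ _ losing)
  ... | i , ¬shown with guard
  ...   | inj₁ k≥3 with two-others k≥3 i
  ...     | j₁ , j₂ , j₁≢i , j₂≢i , j₁≢j₂ = j₁≢j₂ (Maybe.just-injective
              (trans (sym (A-vertex-colour dom ¬shown x₀∈A j₁≢i)) (A-vertex-colour dom ¬shown x₀∈A j₂≢i)))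
  BobWinning⇒¬finished {c = c} p x₀∈A comp dom (losing , guard) | i , ¬shown | inj₂ (_ , reserve)
    with Reserve⇒Obstructed⊎free p reserve
  ...     | inj₁ obstructed = Obstructed⇒¬dominating dom ¬shown obstructed
  ...     | inj₂ one with 1≤count⇒∃ (free? inB? c) one
  ...       | _ , _ , cv = complete⇒¬free comp cv

  no-waste-with-two-colours : k ≡ 2 → Losing alice (tally inA? c) r → ¬ CanWaste (tally inA? c)
  no-waste-with-two-colours {c = c} k≡2 losing can-waste@(_ , shown≥1)
    with 1≤count⇒∃ (shows? inA? c) shown≥1
  ... | j , shown =
    <⇒≱ (subst (missing (tally inA? c) <_) k≡2 missing<k) (Losing-alice-waste⇒missing≥2 _ losing can-waste)
    where missing<k = ¬⇒count<N (¬? ∘ shows? inA? c) j (λ ¬shown → ¬shown shown)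

  some-colour : ∀ p → Guard p c → Fin k
  some-colour _ (inj₁ k≥3)       = fromℕ< (≤-trans (s≤s z≤n) k≥3)
  some-colour _ (inj₂ (k≡2 , _)) = fromℕ< (subst (0 <_) (sym k≡2) (s≤s z≤n))

  Guard-map : ∀ p q {c′} → (k ≡ 2 → Reserve p c → Reserve q c′) → Guard p c → Guard q c′
  Guard-map _ _ f (inj₁ k≥3)       = inj₁ k≥3
  Guard-map _ _ f (inj₂ (k≡2 , r)) = inj₂ (k≡2 , f k≡2 r)

  module _ {c : Pos} {v : V} (cv : c v ≡ nothing) where

    BobWinning-after-alice : BobWinning alice c → ∀ i → BobWinning bob (c [ v ≔ i ])
    BobWinning-after-alice (losing , guard) i with inA? v
    ... | yes v∈A = subst (Losing bob (tally inA? (c [ v ≔ i ]))) (sym freeB≡)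
                      (Losing-after-alice-A _ losing (tally-step inA? cv v∈A)) ,
                    Guard-map alice bob next-reserve guard
      where
      freeB≡ : freeB (c [ v ≔ i ]) ≡ freeB c
      freeB≡ = cong free (tally-outside inB? cv λ v∉A → v∉A v∈A)
      next-reserve : k ≡ 2 → Reserve alice c → Reserve bob (c [ v ≔ i ])
      next-reserve _ (inj₁ obstructed) = inj₁ (Obstructed-assign cv obstructed)
      next-reserve _ (inj₂ two)        =
        inj₂ (inj₂ (inj₁ (subst (2 ≤_) (sym freeB≡) two , inj₁ (i , Shows-assign-new v∈A))))
    ... | no v∉A = subst (λ t → Losing bob t (freeB (c [ v ≔ i ]))) (sym tallyA≡)
                     (Losing-after-alice-B _ (subst (Losing alice (tally inA? c)) (free-inside inB? cv v∉A) losing)) ,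
                   Guard-map alice bob next-reserve guard
      where
      tallyA≡ : tally inA? (c [ v ≔ i ]) ≡ tally inA? c
      tallyA≡ = tally-outside inA? cv v∉A
      next-reserve : k ≡ 2 → Reserve alice c → Reserve bob (c [ v ≔ i ])
      next-reserve _   (inj₁ obstructed) = inj₁ (Obstructed-assign cv obstructed)
      next-reserve k≡2 (inj₂ two)        = inj₂ (inj₂ (inj₂
        ( ≤-pred (subst (2 ≤_) (free-inside inB? cv v∉A) two)
        , inj₂ (i , Shows-assign-new v∉A)
        , subst (¬_ ∘ CanWaste) (sym tallyA≡) (no-waste-with-two-colours k≡2 losing))))

    BobWinning-after-bob-A : ∀ {i tA′} → CanWaste (tally inA? c) ⊎ freeB c ≡ 0 → InA v →
                             tally inA? (c [ v ≔ i ]) ≡ tA′ → Losing alice tA′ (freeB c) → Guard bob c →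
                             BobWinning alice (c [ v ≔ i ])
    BobWinning-after-bob-A {i} waste-or-full v∈A tallyA≡ losing guard =
      subst₂ (Losing alice) (sym tallyA≡) (sym freeB≡) losing , Guard-map bob alice next-reserve guard
      where
      freeB≡ : freeB (c [ v ≔ i ]) ≡ freeB c
      freeB≡ = cong free (tally-outside inB? cv λ v∉A → v∉A v∈A)
      next-reserve : k ≡ 2 → Reserve bob c → Reserve alice (c [ v ≔ i ])
      next-reserve _ (inj₁ obstructed)                         = inj₁ (Obstructed-assign cv obstructed)
      next-reserve _ (inj₂ (inj₁ three))                       =
        inj₂ (subst (2 ≤_) (sym freeB≡) (≤-trans (n≤1+n 2) three))
      next-reserve _ (inj₂ (inj₂ (inj₁ (two , _))))            = inj₂ (subst (2 ≤_) (sym freeB≡) two)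
      next-reserve _ (inj₂ (inj₂ (inj₂ (one , _ , no-waste)))) =
        ⊥-elim ([ no-waste , (λ full → <⇒≢ one (sym full)) ] waste-or-full)

    obstruct : k ≡ 2 → InB v → Obstructible c → ∃ λ i → Guard alice (c [ v ≔ i ])
    obstruct k≡2 v∈B (inj₁ (j , shownA)) = j , inj₂ (k≡2 , inj₁ (j , Shows-assign-new v∈B , inj₁ (Shows-assign cv shownA)))
    obstruct k≡2 v∈B (inj₂ (j , shownB)) =
      let j′ , j≢j′ = other-colour (subst (2 ≤_) (sym k≡2) ≤-refl) j
      in  j′ , inj₂ (k≡2 , inj₁ (j′ , Shows-assign-new v∈B , inj₂ (j , j≢j′ ∘ sym , Shows-assign cv shownB)))

    bob-colour-on-B : InB v → Guard bob c → ∃ λ i → Guard alice (c [ v ≔ i ])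
    bob-colour-on-B v∈B guard@(inj₁ k≥3) = some-colour bob guard , inj₁ k≥3
    bob-colour-on-B v∈B guard@(inj₂ (k≡2 , reserve)) with reserve
    ... | inj₁ obstructed = some-colour bob guard , inj₂ (k≡2 , inj₁ (Obstructed-assign cv obstructed))
    ... | inj₂ (inj₁ three) =
      some-colour bob guard , inj₂ (k≡2 , inj₂ (≤-pred (subst (3 ≤_) (free-inside inB? cv v∈B) three)))
    ... | inj₂ (inj₂ (inj₁ (_ , obstructible)))     = obstruct k≡2 v∈B obstructible
    ... | inj₂ (inj₂ (inj₂ (_ , obstructible , _))) = obstruct k≡2 v∈B obstructible

  bob-wins : ∀ {p c x₀} → InA x₀ → AliceWins (K m n) k p c → BobWinning p c → ⊥
  bob-wins x₀∈A (finished comp dom) bw = BobWinning⇒¬finished _ x₀∈A comp dom bw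
  bob-wins x₀∈A (aliceMove v i cv w) bw = bob-wins x₀∈A w (BobWinning-after-alice cv bw i)
  bob-wins x₀∈A (bobMove (_ , cv₀) f) (losing , guard) with bob-reply _ _ losing (free-side cv₀)
  ... | on-A waste-or-full mv losing′ with realise inA? refl mv
  ...   | v , i , cv , v∈A , tallyA≡ =
    bob-wins x₀∈A (f v i cv) (BobWinning-after-bob-A cv waste-or-full v∈A tallyA≡ losing′ guard)
  bob-wins {c = c} x₀∈A (bobMove _ f) (losing , guard) | on-B _ freeB≡ losing′
    with count≡suc⇒∃ (free? inB? c) freeB≡
  ...   | v , v∈B , cv with bob-colour-on-B cv v∈B guard
  ...     | i , guard′ = bob-wins x₀∈A (f v i cv)
                           (subst₂ (Losing alice) (sym (tally-outside inA? cv v∈B))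
                                   (suc-injective (trans (sym freeB≡) (free-inside inB? cv v∈B))) losing′ , guard′)

-- The game domatic numbers

largest-winning : ∀ p {m n d} → 1 ≤ m → Winning p ⟨ m , d , 0 ⟩ ⟨ n , d , 0 ⟩ →
                  (∀ k → d < k → Losing p ⟨ m , k , 0 ⟩ n × (3 ≤ k ⊎ (k ≡ 2 × reserve p ≤ n))) →
                  IsLargestWinning p (K m n) d
largest-winning p {m} {n} {d} m≥1 winning losing = alice-wins-initially , bob-wins-initially
  where
  alice-wins-initially : AliceWins (K m n) d p (emptyPos (K m n) d)
  alice-wins-initially = alice-wins _ p _ refl (subst₂ (Winning p) (sym tallyA-empty) (sym tallyB-empty) winning)
    where
    open Colouring m n d
    open AliceStrategy m n d

  bob-wins-initially : ∀ k → d < k → ¬ AliceWins (K m n) k p (emptyPos (K m n) k)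
  bob-wins-initially k d<k w with losing k d<k
  ... | losing₀ , guard₀ =
    bob-wins x₀∈A w (subst₂ (Losing p) (sym tallyA-empty) (sym freeB-empty) losing₀ , guard guard₀)
    where
    open Colouring m n k
    open BobStrategy m n k
    freeB-empty : freeB empty ≡ n
    freeB-empty = cong free tallyB-empty
    x₀∈A : InA (fromℕ< (≤-trans m≥1 (m≤m+n m n)))
    x₀∈A = subst (_< m) (sym (Fin.toℕ-fromℕ< _)) m≥1
    guard : 3 ≤ k ⊎ (k ≡ 2 × reserve p ≤ n) → Guard p empty
    guard (inj₁ k≥3)       = inj₁ k≥3
    guard (inj₂ (k≡2 , r)) = inj₂ (k≡2 , Reserve-initial p (subst (reserve p ≤_) (sym freeB-empty) r))

fresh-start : ∀ p {m n d} → 1 ≤ m → 1 ≤ d → d + d ≤ 2 + m → m ≤ n → (d + d ≡ 2 + m → playerAfter n p ≡ bob) →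
              Winning p ⟨ m , d , 0 ⟩ ⟨ n , d , 0 ⟩
fresh-start p {m} {n} {d} m≥1 d≥1 dd≤ m≤n tightA⇒bob =
  (m≥1 , d≥1 , deficit≤ dd≤ , λ (deficit≡ e) → tightA⇒bob e) ,
  (≤-trans m≥1 m≤n , d≥1 , deficit≤ (≤-trans dd≤ (s≤s (s≤s m≤n))) , λ (deficit≡ e) → tightB⇒bob e)
  where
  tightB⇒bob : d + d ≡ 2 + n → playerAfter m p ≡ bob
  tightB⇒bob e with refl ← ≤-antisym m≤n (≤-pred (≤-pred (subst (_≤ 2 + m) e dd≤))) = tightA⇒bob e

many-colours : ∀ p {m n k} → 3 + m ≤ k + k → 3 ≤ k → Losing p ⟨ m , k , 0 ⟩ n × (3 ≤ k ⊎ (k ≡ 2 × reserve p ≤ n))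
many-colours p 3+m≤kk k≥3 = inj₁ (deficit≥ 3+m≤kk) , inj₁ k≥3

colours-beyond : ∀ {m h k} → m ≤ suc (h + h) → 2 + h ≤ k → 3 + m ≤ k + k
colours-beyond {m} {h} {k} m≤ h+2≤k = begin
  3 + m                      ≤⟨ s≤s (s≤s (s≤s m≤)) ⟩
  2 + (2 + (h + h))          ≡⟨ cong (2 +_) (sym (suc+suc h h)) ⟩
  2 + (suc h + suc h)        ≡⟨ sym (suc+suc (suc h) (suc h)) ⟩
  (2 + h) + (2 + h)          ≤⟨ +-mono-≤ h+2≤k h+2≤k ⟩
  k + k                      ∎
  where open ≤-Reasoning

reserve-suffices : ∀ p {n} → 2 ≤ n → playerAfter n p ≡ alice → reserve p ≤ n
reserve-suffices alice n≥2 _ = n≥2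
reserve-suffices bob {suc zero} (s≤s ()) _
reserve-suffices bob {suc (suc zero)} _ ()
reserve-suffices bob {suc (suc (suc _))} _ _ = s≤s (s≤s (s≤s z≤n))

half-domatic : ∀ p {m n h} → m ≡ h + h → 1 ≤ h → m ≤ n → playerAfter n p ≡ alice → IsLargestWinning p (K m n) h
half-domatic p {m} {n} {h} refl h≥1 m≤n after =
  largest-winning p (≤-trans h≥1 (m≤m+n h h)) alice-start bob-start
  where
  alice-start : Winning p ⟨ h + h , h , 0 ⟩ ⟨ n , h , 0 ⟩
  alice-start = fresh-start p (≤-trans h≥1 (m≤m+n h h)) h≥1 (m≤n⇒m≤o+n 2 ≤-refl) m≤n
                  λ e → ⊥-elim (<⇒≢ (s≤s (n≤1+n _)) e)
  bob-start : ∀ k → h < k → Losing p ⟨ h + h , k , 0 ⟩ n × (3 ≤ k ⊎ (k ≡ 2 × reserve p ≤ n))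
  bob-start k h<k with m≤n⇒m<n∨m≡n h<k
  ... | inj₁ h+1<k = many-colours p (colours-beyond (n≤1+n _) h+1<k) (≤-trans (s≤s (s≤s h≥1)) h+1<k)
  ... | inj₂ refl  = inj₂ (deficit≡ (suc+suc h h) , after) , guard h≥1 m≤n
    where
    guard : ∀ {h} → 1 ≤ h → h + h ≤ n → 3 ≤ suc h ⊎ (suc h ≡ 2 × reserve p ≤ n)
    guard {suc zero}    _ n≥2 = inj₂ (refl , reserve-suffices p n≥2 after)
    guard {suc (suc _)} _ _   = inj₁ (s≤s (s≤s (s≤s z≤n)))

half-up-domatic : ∀ p {m n h} → h + h ≤ m → m ≤ suc (h + h) → (m ≡ h + h → playerAfter n p ≡ bob) → 1 ≤ h → m ≤ n →
                  IsLargestWinning p (K m n) (suc h)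
half-up-domatic p {m} {n} {h} lower upper even⇒bob h≥1 m≤n = largest-winning p m≥1 alice-start bob-start
  where
  m≥1 : 1 ≤ m
  m≥1 = ≤-trans h≥1 (≤-trans (m≤m+n h h) lower)
  alice-start : Winning p ⟨ m , suc h , 0 ⟩ ⟨ n , suc h , 0 ⟩
  alice-start = fresh-start p m≥1 (s≤s z≤n) (subst (_≤ 2 + m) (sym (suc+suc h h)) (s≤s (s≤s lower))) m≤n
                  λ e → even⇒bob (sym (suc-injective (suc-injective (trans (sym (suc+suc h h)) e))))
  bob-start : ∀ k → suc h < k → Losing p ⟨ m , k , 0 ⟩ n × (3 ≤ k ⊎ (k ≡ 2 × reserve p ≤ n))
  bob-start k h+1<k = many-colours p (colours-beyond upper h+1<k) (≤-trans (s≤s (s≤s h≥1)) h+1<k)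

theorem5p5 : (m n : ℕ) → 2 ≤ m → m ≤ n →
    ((Even m × Even n → GameDomaticNumber (K m n) ⌊ m /2⌋) ×
     (¬ (Even m × Even n) → GameDomaticNumber (K m n) ⌈ m + 1 /2⌉)) ×
    ((Even m × ¬ Even n → DelayedGameDomaticNumber (K m n) ⌊ m /2⌋) ×
     (¬ (Even m × ¬ Even n) → DelayedGameDomaticNumber (K m n) ⌈ m + 1 /2⌉))
theorem5p5 m n m≥2 m≤n =
  ( (λ (em , en) → half alice em (playerAfter-even alice en))
  , (λ ¬ee → half-up alice λ (em , after) → ¬ee (em , playerAfter≡self⇒even alice after)) ) ,
  ( (λ (em , ¬en) → half bob em (playerAfter-odd bob ¬en))
  , (λ ¬eo → half-up bob λ (em , after) →
       ¬eo (em , λ en → opponent≢ bob (trans (sym after) (playerAfter-even bob en)))) )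
  where
  h≥1 : 1 ≤ ⌊ m /2⌋
  h≥1 = ⌊n/2⌋-mono m≥2

  half : ∀ p → Even m → playerAfter n p ≡ alice → IsLargestWinning p (K m n) ⌊ m /2⌋
  half p em = half-domatic p (even⇒double em) h≥1 m≤n

  half-up : ∀ p → ¬ (Even m × playerAfter n p ≡ alice) → IsLargestWinning p (K m n) ⌈ m + 1 /2⌉
  half-up p ¬half = subst (IsLargestWinning p (K m n)) (sym (⌈m+1/2⌉≡suc⌊m/2⌋ m))
    (half-up-domatic p {h = ⌊ m /2⌋} (⌊/2⌋-double≤ m) (≤suc-⌊/2⌋-double m)
      (λ e → ≢alice⇒≡bob λ after → ¬half (subst Even (sym e) (even-double ⌊ m /2⌋) , after)) h≥1 m≤n)
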